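{- Let $k\geq 3$ and $i\in[k-2]$, and let $p=(A/B)$ be the complete bipartite partially ordered pattern of length $k$ with $A=\{i,i+2\}$ and $B=[k]\setminus A$. Let $a(n)$ denote the number of permutations of $[n]$ avoiding $p$. Then $$a(n)=\begin{cases} n! & \text{if } n<k,\\ 2(k-2)\,a(n-1)-(k-2)(k-3)\,a(n-2) & \text{if } n\geq k.\end{cases}$$
   Context: For $A\subset[k]$ and $B=[k]\setminus A$, the complete bipartite partially ordered pattern $(A/B)$ of length $k$ is defined as follows: an occurrence of $(A/B)$ in a permutation $\pi=\pi_1\cdots\pi_n$ is a subsequence $\pi_{i_1}\cdots\pi_{i_k}$ with $1\le i_1<\cdots<i_k\le n$ such that $\pi_{i_a}>\pi_{i_b}$ for every $a\in A$ and every $b\in B$. A permutation avoids the pattern if it has no occurrence of it. Here $[m]=\{1,\dots,m\}$ and the empty permutation is counted for $n=0$. -}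

module Defs where

open import Data.Nat using (ℕ; zero; suc; _+_; _∸_)
open import Data.Fin using (Fin; toℕ) renaming (_<_ to _<ᶠ_)
open import Data.Vec using (Vec; lookup)
open import Data.List using (List; length)
open import Data.List.Relation.Unary.Unique.Propositional using (Unique)
open import Data.List.Membership.Propositional using (_∈_)
open import Data.Product using (Σ; _×_; ∃)
open import Data.Sum using (_⊎_)
open import Relation.Nullary using (¬_)
open import Relation.Binary.PropositionalEquality using (_≡_)
open import Function.Bundles using (_⇔_)

-- A permutation of [n] is represented in one-line notation as a vector
-- π = π_1 ⋯ π_n of values in Fin n (values 0..n-1 stand for 1..n)
-- with no repeated entry (hence a bijection).
IsPerm : (n : ℕ) → Vec (Fin n) n → Set
IsPerm n π = (x y : Fin n) → lookup π x ≡ lookup π y → x ≡ y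

-- A subset A of the positions [k] (0-indexed as Fin k), given as a predicate.
Occurrence : (k : ℕ) (A : Fin k → Set) (n : ℕ) → Vec (Fin n) n → Set
Occurrence k A n π =
  Σ (Fin k → Fin n) λ ι →
    ((a b : Fin k) → a <ᶠ b → ι a <ᶠ ι b) ×
    ((a b : Fin k) → A a → ¬ A b → lookup π (ι b) <ᶠ lookup π (ι a))

Avoids : (k : ℕ) (A : Fin k → Set) (n : ℕ) → Vec (Fin n) n → Set
Avoids k A n π = ¬ Occurrence k A n π

-- The set A = {i, i+2} ⊆ [k] (1-indexed), i.e. 0-indexed positions i-1 and i+1.
A-i-i+2 : (k i : ℕ) → Fin k → Set
A-i-i+2 k i j = (toℕ j ≡ i ∸ 1) ⊎ (toℕ j ≡ suc i)

HasCard : {X : Set} → (X → Set) → ℕ → Set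
HasCard {X} P m =
  Σ (List X) λ L → Unique L × (length L ≡ m) × ((x : X) → (x ∈ L) ⇔ P x)

NumAvoiders : (k : ℕ) (A : Fin k → Set) (n m : ℕ) → Set
NumAvoiders k A n m = HasCard (λ (π : Vec (Fin n) n) → IsPerm n π × Avoids k A n π) m

{-# OPTIONS --safe #-}
-- Every avoider of length n + 1 arises exactly once by inserting the maximum into a gap of an
-- avoider of length n, since deleting the maximum preserves avoidance. Write l = i - 1 and
-- r = k - i - 2, and call a position dead if fewer than l positions precede it or fewer than r
-- follow it: no letter of A = {i, i + 2} fits there. Only the letters of A can carry the two
-- largest values of an occurrence, so inserting the maximum at a dead gap always yields an
-- avoider, and once n ≥ k - 3 exactly c = k - 3 of the n + 1 gaps are dead.
-- Let f σ be the number of avoiding children of σ. A dead child has f σ + 1 avoiding children: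
-- those of σ, with the old maximum deleted, plus the one with the new maximum just before the
-- old one. A live avoiding child has c + 2: the c dead gaps and the two gaps next to the old
-- maximum; at any other gap the two largest values sit at live, non-adjacent positions and
-- complete an occurrence. Summing c (f σ + 1) + (f σ - c) (c + 2) over σ gives the recurrence.
module Submission where

open import Defs
open import Data.Nat using (ℕ; zero; suc; _+_; _*_; _∸_; _≤_; _<_; _!; z≤n; s≤s; _≟_; _≤?_; _<?_)
open import Data.Nat.Properties
open import Data.Nat.Solver using (module +-*-Solver)
open import Data.Nat.ListAction using (sum)
open import Data.Nat.ListAction.Properties using (sum-++)
open import Data.Fin as F using (Fin; toℕ; fromℕ; fromℕ<; inject₁; punchIn; punchOut; lower₁)
  renaming (zero to fz; suc to fs)
import Data.Fin.Properties as FP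
open import Data.Vec as V using (Vec; lookup; insertAt)
open import Data.Vec.Properties using (insertAt-lookup; insertAt-punchIn; lookup-map; lookup∘tabulate; ≡-dec)
open import Data.Vec.Relation.Binary.Pointwise.Extensional using (ext; Pointwise-≡⇒≡)
open import Data.List using (List; []; _∷_; _++_; length; map; filter; tabulate; allFin)
open import Data.List.Properties using (map-++; map-∘; map-cong-local)
open import Data.List.Membership.Propositional using (_∈_)
open import Data.List.Membership.Propositional.Properties
  using (∈-++⁺ˡ; ∈-++⁺ʳ; ∈-++⁻; ∈-map⁺; ∈-map⁻; ∈-filter⁺; ∈-filter⁻; ∈-allFin)
open import Data.List.Membership.Propositional.Properties.WithK using (unique∧set⇒bag)
open import Data.List.Membership.DecPropositional using () renaming (_∈?_ to ∈?[_])
open import Data.List.Relation.Unary.Any using (here; there)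
import Data.List.Relation.Unary.All as All
open import Data.List.Relation.Unary.AllPairs using ([]; _∷_)
open import Data.List.Relation.Unary.Unique.Propositional using (Unique)
import Data.List.Relation.Unary.Unique.Propositional.Properties as Unique
open import Data.List.Relation.Binary.BagAndSetEquality using (∼bag⇒↭)
open import Data.List.Relation.Binary.Permutation.Propositional.Properties using (↭-length)
open import Data.Product using (Σ; ∃; _×_; _,_; proj₁; proj₂; swap)
open import Data.Sum using (_⊎_; inj₁; inj₂)
open import Data.Empty using (⊥; ⊥-elim)
open import Function using (_∘_)
open import Function.Bundles using (_⇔_; mk⇔; Equivalence)
import Function.Properties.Equivalence as ⇔
open import Relation.Nullary using (¬_; Dec; yes; no)
open import Relation.Binary using (tri<; tri≈; tri>)
open import Relation.Binary.PropositionalEquality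
  using (_≡_; _≢_; refl; sym; trans; cong; cong₂; subst; subst₂; module ≡-Reasoning)

-- Positions

Perm : ℕ → Set
Perm n = Vec (Fin n) n

toℕ-punchIn-< : ∀ {n} (i : Fin (suc n)) (j : Fin n) → toℕ j < toℕ i → toℕ (punchIn i j) ≡ toℕ j
toℕ-punchIn-< (fs i) fz      _       = refl
toℕ-punchIn-< (fs i) (fs j) (s≤s p) = cong suc (toℕ-punchIn-< i j p)

toℕ-punchIn-≥ : ∀ {n} (i : Fin (suc n)) (j : Fin n) → toℕ i ≤ toℕ j → toℕ (punchIn i j) ≡ suc (toℕ j)
toℕ-punchIn-≥ fz     j      _       = refl
toℕ-punchIn-≥ (fs i) (fs j) (s≤s p) = cong suc (toℕ-punchIn-≥ i j p)

punchIn-mono-< : ∀ {n} (i : Fin (suc n)) (j j′ : Fin n) → j F.< j′ → punchIn i j F.< punchIn i j′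
punchIn-mono-< i j j′ j<j′ = ≰⇒> (λ le → <⇒≱ j<j′ (FP.punchIn-cancel-≤ i j′ j le))

pivot-or-punchIn : ∀ {n} (i j : Fin (suc n)) → j ≡ i ⊎ ∃ λ x → j ≡ punchIn i x
pivot-or-punchIn i j with j F.≟ i
... | yes j≡i = inj₁ j≡i
... | no  j≢i = inj₂ (punchOut i≢j , sym (FP.punchIn-punchOut i≢j))
  where i≢j = λ i≡j → j≢i (sym i≡j)

punchIn-inject₁-pivot : ∀ {n} (d y : Fin (suc n)) →
  punchIn (punchIn (punchIn (inject₁ d) y) d) y ≡ punchIn (inject₁ d) y
punchIn-inject₁-pivot fz              y      = refl
punchIn-inject₁-pivot {suc n} (fs d) fz     = refl
punchIn-inject₁-pivot {suc n} (fs d) (fs y) = cong fs (punchIn-inject₁-pivot d y)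

punchIn-inject₁-punchIn : ∀ {n} (d y : Fin (suc n)) (w : Fin n) →
  punchIn (punchIn (punchIn (inject₁ d) y) d) (punchIn y w) ≡ punchIn (punchIn (inject₁ d) y) (punchIn d w)
punchIn-inject₁-punchIn fz              y      w      = refl
punchIn-inject₁-punchIn {suc n} (fs d) fz     w      = refl
punchIn-inject₁-punchIn {suc n} (fs d) (fs y) fz     = refl
punchIn-inject₁-punchIn {suc n} (fs d) (fs y) (fs w) = cong fs (punchIn-inject₁-punchIn d y w)

punchIn-inject₁-self : ∀ {n} (g : Fin (suc n)) → punchIn (inject₁ g) g ≡ fs g
punchIn-inject₁-self fz              = refl
punchIn-inject₁-self {suc n} (fs g) = cong fs (punchIn-inject₁-self g)

Adjacent : ∀ {N} → Fin N → Fin N → Set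
Adjacent x y = toℕ y ≡ suc (toℕ x) ⊎ toℕ x ≡ suc (toℕ y)

module _ {N : ℕ} {t s : Fin N} where

  adjacent⇒≢ : Adjacent t s → s ≢ t
  adjacent⇒≢ (inj₁ s≡t+1) refl = 1+n≢n (sym s≡t+1)
  adjacent⇒≢ (inj₂ t≡s+1) refl = 1+n≢n (sym t≡s+1)

  adjacent-above : Adjacent t s → ∀ {y} → t F.< y → y ≢ s → s F.< y
  adjacent-above (inj₁ s≡t+1) t<y y≢s =
    ≤∧≢⇒< (subst (_≤ _) (sym s≡t+1) t<y) (λ s≡y → y≢s (FP.toℕ-injective (sym s≡y)))
  adjacent-above (inj₂ t≡s+1) t<y _ = <-trans (subst (toℕ s <_) (sym t≡s+1) (n<1+n _)) t<y

  adjacent-below : Adjacent t s → ∀ {x} → x F.< t → x ≢ s → x F.< s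
  adjacent-below (inj₁ s≡t+1) x<t _ = <-trans x<t (subst (toℕ t <_) (sym s≡t+1) (n<1+n _))
  adjacent-below (inj₂ t≡s+1) x<t x≢s =
    ≤∧≢⇒< (≤-pred (subst (_ <_) t≡s+1 x<t)) (λ x≡s → x≢s (FP.toℕ-injective x≡s))

adjacent-inject₁ : ∀ {n} (g : Fin (suc n)) → Adjacent (inject₁ g) (punchIn (inject₁ g) g)
adjacent-inject₁ g = inj₁ (trans (toℕ-punchIn-≥ (inject₁ g) g (≤-reflexive (FP.toℕ-inject₁ g)))
                                 (cong suc (sym (FP.toℕ-inject₁ g))))

adjacent-suc : ∀ {n} (g : Fin (suc n)) → Adjacent (fs g) (punchIn (fs g) g)
adjacent-suc g = inj₂ (cong suc (sym (toℕ-punchIn-< (fs g) g (n<1+n _))))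

-- Inserting a new maximum

insertMax : ∀ {n} → Perm n → Fin (suc n) → Perm (suc n)
insertMax {n} σ g = insertAt (V.map inject₁ σ) g (fromℕ n)

module _ {n : ℕ} (σ : Perm n) (g : Fin (suc n)) where

  insertMax-pivot : lookup (insertMax σ g) g ≡ fromℕ n
  insertMax-pivot = insertAt-lookup (V.map inject₁ σ) g _

  insertMax-punchIn : ∀ x → lookup (insertMax σ g) (punchIn g x) ≡ inject₁ (lookup σ x)
  insertMax-punchIn x = trans (insertAt-punchIn (V.map inject₁ σ) g _ x) (lookup-map x inject₁ σ)

  toℕ-insertMax-pivot : toℕ (lookup (insertMax σ g) g) ≡ n
  toℕ-insertMax-pivot = trans (cong toℕ insertMax-pivot) (FP.toℕ-fromℕ n)

  toℕ-insertMax-punchIn : ∀ x → toℕ (lookup (insertMax σ g) (punchIn g x)) ≡ toℕ (lookup σ x)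
  toℕ-insertMax-punchIn x = trans (cong toℕ (insertMax-punchIn x)) (FP.toℕ-inject₁ _)

  insertMax-punchIn<n : ∀ x → toℕ (lookup (insertMax σ g) (punchIn g x)) < n
  insertMax-punchIn<n x = subst (_< n) (sym (toℕ-insertMax-punchIn x)) (FP.toℕ<n (lookup σ x))

  insertMax-pivot≢punchIn : ∀ x → lookup (insertMax σ g) g ≢ lookup (insertMax σ g) (punchIn g x)
  insertMax-pivot≢punchIn x eq =
    <-irrefl (trans (sym (cong toℕ eq)) toℕ-insertMax-pivot) (insertMax-punchIn<n x)

  insertMax-isPerm : IsPerm n σ → IsPerm (suc n) (insertMax σ g)
  insertMax-isPerm σ-inj x y eq with pivot-or-punchIn g x | pivot-or-punchIn g y
  ... | inj₁ refl        | inj₁ refl        = refl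
  ... | inj₁ refl        | inj₂ (y′ , refl) = ⊥-elim (insertMax-pivot≢punchIn y′ eq)
  ... | inj₂ (x′ , refl) | inj₁ refl        = ⊥-elim (insertMax-pivot≢punchIn x′ (sym eq))
  ... | inj₂ (x′ , refl) | inj₂ (y′ , refl) = cong (punchIn g) (σ-inj x′ y′ (FP.inject₁-injective
    (trans (sym (insertMax-punchIn x′)) (trans eq (insertMax-punchIn y′)))))

module _ {n : ℕ} (σ : Perm n) (g : Fin (suc n)) (h : Fin (suc (suc n))) where

  toℕ-insertMax²-old-pivot : toℕ (lookup (insertMax (insertMax σ g) h) (punchIn h g)) ≡ n
  toℕ-insertMax²-old-pivot = trans (toℕ-insertMax-punchIn (insertMax σ g) h g) (toℕ-insertMax-pivot σ g)

  insertMax²-others<n : ∀ w → w ≢ h → w ≢ punchIn h g → toℕ (lookup (insertMax (insertMax σ g) h) w) < n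
  insertMax²-others<n w w≢h w≢q with pivot-or-punchIn h w
  ... | inj₁ w≡h = ⊥-elim (w≢h w≡h)
  ... | inj₂ (z , refl) with pivot-or-punchIn g z
  ...   | inj₁ refl = ⊥-elim (w≢q refl)
  ...   | inj₂ (u , refl) = subst (_< n) (sym (toℕ-insertMax-punchIn (insertMax σ g) h (punchIn g u)))
                              (insertMax-punchIn<n σ g u)

  insertMax²-others-below : ∀ w → w ≢ h → w ≢ punchIn h g →
    let π = insertMax (insertMax σ g) h in
    lookup π w F.< lookup π h × lookup π w F.< lookup π (punchIn h g)
  insertMax²-others-below w w≢h w≢q =
    subst (value w <_) (sym (toℕ-insertMax-pivot (insertMax σ g) h)) (<-trans below-n (n<1+n n)) ,
    subst (value w <_) (sym toℕ-insertMax²-old-pivot) below-n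
    where
      value = λ w → toℕ (lookup (insertMax (insertMax σ g) h) w)
      below-n = insertMax²-others<n w w≢h w≢q

insertMax-injective : ∀ {n} (σ σ′ : Perm n) g g′ → insertMax σ g ≡ insertMax σ′ g′ → σ ≡ σ′ × g ≡ g′
insertMax-injective σ σ′ g g′ eq with g F.≟ g′
... | yes refl = Pointwise-≡⇒≡ (ext λ x → FP.inject₁-injective
      (trans (sym (insertMax-punchIn σ g x))
        (trans (cong (λ v → lookup v (punchIn g x)) eq) (insertMax-punchIn σ′ g x)))) , refl
... | no g≢g′ = ⊥-elim (insertMax-pivot≢punchIn σ′ g′ x
      (trans (insertMax-pivot σ′ g′) (trans (sym (insertMax-pivot σ g))
        (trans (cong (λ v → lookup v g) eq) (cong (lookup (insertMax σ′ g′)) (sym g≡punchIn))))))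
  where
    g′≢g : g′ ≢ g
    g′≢g g′≡g = g≢g′ (sym g′≡g)
    x = punchOut g′≢g
    g≡punchIn : punchIn g′ x ≡ g
    g≡punchIn = FP.punchIn-punchOut g′≢g

maxPosition : ∀ {n} (τ : Perm (suc n)) → IsPerm (suc n) τ → ∃ λ g → lookup τ g ≡ fromℕ n
maxPosition {n} τ τ-inj with FP.injective⇒existsPivot (λ {x} {y} → τ-inj x y) (fromℕ n)
... | g , _ , n≤τg = g , FP.≤-antisym (FP.≤fromℕ _) n≤τg

module _ {n : ℕ} (τ : Perm (suc n)) (τ-inj : IsPerm (suc n) τ) (g : Fin (suc n)) (τg≡n : lookup τ g ≡ fromℕ n) where

  private
    n≢punchIn : ∀ x → n ≢ toℕ (lookup τ (punchIn g x))
    n≢punchIn x eq = FP.punchInᵢ≢i g x (τ-inj _ _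
      (trans (FP.toℕ-injective (trans (sym eq) (sym (FP.toℕ-fromℕ n)))) (sym τg≡n)))

  deleteMax : Perm n
  deleteMax = V.tabulate λ x → lower₁ (lookup τ (punchIn g x)) (n≢punchIn x)

  private
    inject₁-deleteMax : ∀ x → inject₁ (lookup deleteMax x) ≡ lookup τ (punchIn g x)
    inject₁-deleteMax x = trans (cong inject₁ (lookup∘tabulate _ x)) (FP.inject₁-lower₁ _ (n≢punchIn x))

  insertMax-deleteMax : insertMax deleteMax g ≡ τ
  insertMax-deleteMax = Pointwise-≡⇒≡ (ext agree)
    where
      agree : ∀ w → lookup (insertMax deleteMax g) w ≡ lookup τ w
      agree w with pivot-or-punchIn g w
      ... | inj₁ refl       = trans (insertMax-pivot deleteMax g) (sym τg≡n)
      ... | inj₂ (x , refl) = trans (insertMax-punchIn deleteMax g x) (inject₁-deleteMax x)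

  deleteMax-isPerm : IsPerm n deleteMax
  deleteMax-isPerm x y eq = FP.punchIn-injective g x y (τ-inj _ _
    (trans (sym (inject₁-deleteMax x)) (trans (cong inject₁ eq) (inject₁-deleteMax y))))

insertMax-surjective : ∀ {n} (τ : Perm (suc n)) → IsPerm (suc n) τ →
  ∃ λ σ → ∃ λ g → IsPerm n σ × insertMax σ g ≡ τ
insertMax-surjective τ τ-inj with maxPosition τ τ-inj
... | g , τg≡n = deleteMax τ τ-inj g τg≡n , g , deleteMax-isPerm τ τ-inj g τg≡n , insertMax-deleteMax τ τ-inj g τg≡n

-- Occurrences and deletions

StrictlyIncreasing : ∀ {K N} → (Fin K → Fin N) → Set
StrictlyIncreasing ι = ∀ a b → a F.< b → ι a F.< ι b

module _ {N : ℕ} where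

  increasing⇒≥ : ∀ {K} (ι : Fin K → Fin N) → StrictlyIncreasing ι → ∀ a → toℕ a ≤ toℕ (ι a)
  increasing⇒≥ ι inc fz     = z≤n
  increasing⇒≥ {suc K} ι inc (fs a) = begin-strict
    toℕ a                   ≤⟨ increasing⇒≥ (λ b → ι (inject₁ b)) inc∘inject₁ a ⟩
    toℕ (ι (inject₁ a))     <⟨ inc (inject₁ a) (fs a) inject₁a<fsa ⟩
    toℕ (ι (fs a))          ∎
    where
      open ≤-Reasoning
      inject₁a<fsa : inject₁ a F.< fs a
      inject₁a<fsa = subst (_< suc (toℕ a)) (sym (FP.toℕ-inject₁ a)) (n<1+n (toℕ a))
      inc∘inject₁ : StrictlyIncreasing {K} (λ b → ι (inject₁ b))
      inc∘inject₁ b c b<c = inc _ _ (subst₂ _<_ (sym (FP.toℕ-inject₁ b)) (sym (FP.toℕ-inject₁ c)) b<c)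

  increasing⇒room : ∀ {K} (ι : Fin K → Fin N) → StrictlyIncreasing ι →
    ∀ d a → toℕ a + d < K → toℕ (ι a) + d < N
  increasing⇒room ι inc zero    a _ = subst (_< N) (sym (+-identityʳ _)) (FP.toℕ<n (ι a))
  increasing⇒room {K} ι inc (suc d) a a+d<K = begin-strict
    toℕ (ι a) + suc d    ≡⟨ +-suc (toℕ (ι a)) d ⟩
    suc (toℕ (ι a)) + d  ≤⟨ +-monoˡ-≤ d (inc a b a<b) ⟩
    toℕ (ι b) + d        <⟨ increasing⇒room ι inc d b (subst (λ m → m + d < K) (sym toℕb) a+1+d<K) ⟩
    N                    ∎
    where
      open ≤-Reasoning
      a+1+d<K : suc (toℕ a) + d < K
      a+1+d<K = subst (_< K) (+-suc (toℕ a) d) a+d<K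
      a+1<K : suc (toℕ a) < K
      a+1<K = ≤-<-trans (s≤s (m≤m+n (toℕ a) d)) a+1+d<K
      b = fromℕ< a+1<K
      toℕb : toℕ b ≡ suc (toℕ a)
      toℕb = FP.toℕ-fromℕ< a+1<K
      a<b : a F.< b
      a<b = subst (toℕ a <_) (sym toℕb) (n<1+n (toℕ a))

squeeze : ∀ {N v x y} → N ≤ suc (suc v) → v < x → x < N → v < y → y < N → x ≡ y
squeeze {N} {v} N≤2+v v<x x<N v<y y<N = ≤-antisym (below v<y x<N) (below v<x y<N)
  where
    below : ∀ {a b} → v < a → b < N → b ≤ a
    below v<a b<N = ≤-pred (≤-trans b<N (≤-trans N≤2+v (s≤s v<a)))

-- ρ is order isomorphic to π with its entry at position q deleted.
record Deletion {n} (π : Perm (suc n)) (q : Fin (suc n)) (ρ : Perm n) : Set where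
  constructor deletion
  field
    preserves : ∀ x y → lookup ρ x F.< lookup ρ y → lookup π (punchIn q x) F.< lookup π (punchIn q y)
    reflects  : ∀ x y → lookup π (punchIn q x) F.< lookup π (punchIn q y) → lookup ρ x F.< lookup ρ y

insertMax-deletion : ∀ {n} (σ : Perm n) g → Deletion (insertMax σ g) g σ
insertMax-deletion σ g = deletion
  (λ x y → subst₂ _<_ (sym (toℕ-insertMax-punchIn σ g x)) (sym (toℕ-insertMax-punchIn σ g y)))
  (λ x y → subst₂ _<_ (toℕ-insertMax-punchIn σ g x) (toℕ-insertMax-punchIn σ g y))

private
  Raised : ℕ → ℕ → ℕ → Set
  Raised n u v = (u ≡ v × v < n) ⊎ (v ≡ n × u ≡ suc n)

  raised-< : ∀ {n u u′ v v′} → Raised n u v → Raised n u′ v′ → v < v′ → u < u′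
  raised-< (inj₁ (refl , _))    (inj₁ (refl , _))     v<v′ = v<v′
  raised-< (inj₁ (refl , v<n))  (inj₂ (refl , refl))  _    = <-trans v<n (n<1+n _)
  raised-< (inj₂ (refl , refl)) (inj₁ (refl , v′<n))  v<v′ = ⊥-elim (<-asym v<v′ v′<n)
  raised-< (inj₂ (refl , refl)) (inj₂ (refl , refl))  v<v′ = ⊥-elim (<-irrefl refl v<v′)

  raised-<⁻ : ∀ {n u u′ v v′} → Raised n u v → Raised n u′ v′ → u < u′ → v < v′
  raised-<⁻ (inj₁ (refl , _))    (inj₁ (refl , _))     u<u′ = u<u′
  raised-<⁻ (inj₁ (refl , v<n))  (inj₂ (refl , refl))  _    = v<n
  raised-<⁻ (inj₂ (refl , refl)) (inj₁ (refl , v′<n))  u<u′ = ⊥-elim (<-asym u<u′ (<-trans v′<n (n<1+n _)))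
  raised-<⁻ (inj₂ (refl , refl)) (inj₂ (refl , refl))  u<u′ = ⊥-elim (<-irrefl refl u<u′)

-- The old maximum n sits at punchIn h d; the hypotheses say that the other positions line up
-- with those of insertMax σ y.
insertMax²-deletion : ∀ {n} (σ : Perm n) d h y →
  punchIn (punchIn h d) y ≡ h →
  (∀ w → punchIn (punchIn h d) (punchIn y w) ≡ punchIn h (punchIn d w)) →
  Deletion (insertMax (insertMax σ d) h) (punchIn h d) (insertMax σ y)
insertMax²-deletion {n} σ d h y pivot-lines-up punchIn-lines-up = deletion
  (λ x x′ → raised-< (raised x) (raised x′))
  (λ x x′ → raised-<⁻ (raised x) (raised x′))
  where
    τ = insertMax σ d
    π = insertMax τ h
    raised : ∀ x → Raised n (toℕ (lookup π (punchIn (punchIn h d) x))) (toℕ (lookup (insertMax σ y) x))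
    raised x with pivot-or-punchIn y x
    ... | inj₁ refl = inj₂ (toℕ-insertMax-pivot σ y ,
          trans (cong (λ z → toℕ (lookup π z)) pivot-lines-up) (toℕ-insertMax-pivot τ h))
    ... | inj₂ (w , refl) = inj₁ (trans (cong (λ z → toℕ (lookup π z)) (punchIn-lines-up w))
          (trans (toℕ-insertMax-punchIn τ h (punchIn d w))
            (trans (toℕ-insertMax-punchIn σ d w) (sym (toℕ-insertMax-punchIn σ y w)))) ,
          insertMax-punchIn<n σ y w)

module _ {k : ℕ} (A : Fin k → Set) {n : ℕ} {π : Perm (suc n)} {q : Fin (suc n)} {ρ : Perm n} (del : Deletion π q ρ) where

  occurrence-punchIn : Occurrence k A n ρ → Occurrence k A (suc n) π
  occurrence-punchIn (ι , inc , val) =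
    (λ a → punchIn q (ι a)) ,
    (λ a b a<b → punchIn-mono-< q _ _ (inc a b a<b)) ,
    (λ a b Aa ¬Ab → Deletion.preserves del _ _ (val a b Aa ¬Ab))

  deletion-avoids : Avoids k A (suc n) π → Avoids k A n ρ
  deletion-avoids π-avoids o = π-avoids (occurrence-punchIn o)

  occurrence-punchOut : (o : Occurrence k A (suc n) π) → (∀ a → proj₁ o a ≢ q) → Occurrence k A n ρ
  occurrence-punchOut (ι , inc , val) q-unused = ι′ , inc′ , val′
    where
      q≢ι : ∀ a → q ≢ ι a
      q≢ι a eq = q-unused a (sym eq)
      ι′ : Fin k → Fin n
      ι′ a = punchOut (q≢ι a)
      punchIn-ι′ : ∀ a → punchIn q (ι′ a) ≡ ι a
      punchIn-ι′ a = FP.punchIn-punchOut (q≢ι a)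
      inc′ : StrictlyIncreasing ι′
      inc′ a b a<b = ≰⇒> (λ b≤a → <⇒≱ (inc a b a<b) (FP.punchOut-cancel-≤ (q≢ι b) (q≢ι a) b≤a))
      val′ : ∀ a b → A a → ¬ A b → lookup ρ (ι′ b) F.< lookup ρ (ι′ a)
      val′ a b Aa ¬Ab = Deletion.reflects del (ι′ b) (ι′ a)
        (subst₂ (λ u v → lookup π u F.< lookup π v) (sym (punchIn-ι′ b)) (sym (punchIn-ι′ a)) (val a b Aa ¬Ab))

-- Counting

ifDec : ∀ {P : Set} → Dec P → ℕ → ℕ
ifDec (yes _) x = x
ifDec (no  _) _ = 0

ifDec-cong : ∀ {P Q : Set} (P? : Dec P) (Q? : Dec Q) → (P → Q) → (Q → P) → ∀ x → ifDec P? x ≡ ifDec Q? x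
ifDec-cong (yes _) (yes _) _   _   _ = refl
ifDec-cong (yes p) (no ¬q) P→Q _   _ = ⊥-elim (¬q (P→Q p))
ifDec-cong (no ¬p) (yes q) _   Q→P _ = ⊥-elim (¬p (Q→P q))
ifDec-cong (no _)  (no _)  _   _   _ = refl

weightedCount : ∀ N {P : Fin N → Set} → (∀ g → Dec (P g)) → (Fin N → ℕ) → ℕ
weightedCount zero    P? w = 0
weightedCount (suc N) P? w = ifDec (P? fz) (w fz) + weightedCount N (P? ∘ fs) (w ∘ fs)

count : ∀ N {P : Fin N → Set} → (∀ g → Dec (P g)) → ℕ
count N P? = weightedCount N P? (λ _ → 1)

count-cong : ∀ N {P Q : Fin N → Set} (P? : ∀ g → Dec (P g)) (Q? : ∀ g → Dec (Q g)) →
  (∀ g → P g → Q g) → (∀ g → Q g → P g) → count N P? ≡ count N Q?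
count-cong zero    P? Q? P→Q Q→P = refl
count-cong (suc N) P? Q? P→Q Q→P = cong₂ _+_ (ifDec-cong (P? fz) (Q? fz) (P→Q fz) (Q→P fz) 1)
  (count-cong N (P? ∘ fs) (Q? ∘ fs) (P→Q ∘ fs) (Q→P ∘ fs))

count-all : ∀ N {P : Fin N → Set} (P? : ∀ g → Dec (P g)) → (∀ g → P g) → count N P? ≡ N
count-all zero    P? all = refl
count-all (suc N) P? all with P? fz
... | yes _  = cong suc (count-all N (P? ∘ fs) (all ∘ fs))
... | no ¬p = ⊥-elim (¬p (all fz))

count-punchIn : ∀ N {P : Fin (suc N) → Set} {Q : Fin N → Set} (P? : ∀ g → Dec (P g)) (Q? : ∀ g → Dec (Q g)) D →
  P D → (∀ y → P (punchIn D y) → Q y) → (∀ y → Q y → P (punchIn D y)) → count (suc N) P? ≡ suc (count N Q?)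
count-punchIn N P? Q? fz PD P→Q Q→P with P? fz
... | yes _  = cong suc (count-cong N (P? ∘ fs) Q? P→Q Q→P)
... | no ¬p = ⊥-elim (¬p PD)
count-punchIn (suc N) P? Q? (fs D) PD P→Q Q→P = begin
  ifDec (P? fz) 1 + count (suc N) (P? ∘ fs)
    ≡⟨ cong (ifDec (P? fz) 1 +_) (count-punchIn N (P? ∘ fs) (Q? ∘ fs) D PD (P→Q ∘ fs) (Q→P ∘ fs)) ⟩
  ifDec (P? fz) 1 + suc (count N (Q? ∘ fs))
    ≡⟨ +-suc (ifDec (P? fz) 1) _ ⟩
  suc (ifDec (P? fz) 1 + count N (Q? ∘ fs))
    ≡⟨ cong (λ z → suc (z + count N (Q? ∘ fs))) (ifDec-cong (P? fz) (Q? fz) (P→Q fz) (Q→P fz) 1) ⟩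
  suc (count (suc N) Q?) ∎
  where open ≡-Reasoning

-- The sum of weights a on D ⊆ P and b on P ∖ D, stated without subtraction.
weightedCount-split : ∀ N {P D : Fin N → Set} (P? : ∀ g → Dec (P g)) (D? : ∀ g → Dec (D g)) (w : Fin N → ℕ) a b →
  (∀ g → D g → P g) → (∀ g → P g → D g → w g ≡ a) → (∀ g → P g → ¬ D g → w g ≡ b) →
  weightedCount N P? w + b * count N D? ≡ a * count N D? + b * count N P?
weightedCount-split zero P? D? w a b D⊆P on-D off-D =
  trans (*-zeroʳ b) (sym (cong₂ _+_ (*-zeroʳ a) (*-zeroʳ b)))
weightedCount-split (suc N) P? D? w a b D⊆P on-D off-D
  with P? fz | D? fz
     | weightedCount-split N (P? ∘ fs) (D? ∘ fs) (w ∘ fs) a b (D⊆P ∘ fs) (on-D ∘ fs) (off-D ∘ fs)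
... | yes p | yes d | ih rewrite on-D fz p d =
  trans (on-both a b _ _) (trans (cong (λ z → a + b + z) ih) (sym (on-both′ a b _ _)))
  where
    open +-*-Solver
    on-both : ∀ a b W c → (a + W) + b * suc c ≡ a + b + (W + b * c)
    on-both = solve 4 (λ a b W c → (a :+ W) :+ b :* (con 1 :+ c) := a :+ b :+ (W :+ b :* c)) refl
    on-both′ : ∀ a b c c′ → a * suc c + b * suc c′ ≡ a + b + (a * c + b * c′)
    on-both′ = solve 4 (λ a b c c′ → a :* (con 1 :+ c) :+ b :* (con 1 :+ c′) := a :+ b :+ (a :* c :+ b :* c′)) refl
... | yes p | no ¬d | ih rewrite off-D fz p ¬d =
  trans (+-assoc b _ _) (trans (cong (b +_) ih) (on-P a b _ _))
  where
    open +-*-Solver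
    on-P : ∀ a b c c′ → b + (a * c + b * c′) ≡ a * c + b * suc c′
    on-P = solve 4 (λ a b c c′ → b :+ (a :* c :+ b :* c′) := a :* c :+ b :* (con 1 :+ c′)) refl
... | no ¬p | yes d | _  = ⊥-elim (¬p (D⊆P fz d))
... | no _  | no _  | ih = ih

countFrom : ∀ {Q : ℕ → Set} → (∀ j → Dec (Q j)) → ℕ → ℕ → ℕ
countFrom Q? s zero    = 0
countFrom Q? s (suc N) = ifDec (Q? s) 1 + countFrom Q? (suc s) N

module _ {Q : ℕ → Set} (Q? : ∀ j → Dec (Q j)) where

  count-toℕ : ∀ s N → count N (λ g → Q? (s + toℕ g)) ≡ countFrom Q? s N
  count-toℕ s zero    = refl
  count-toℕ s (suc N) = cong₂ _+_
    (ifDec-cong (Q? (s + 0)) (Q? s) (subst Q (+-identityʳ s)) (subst Q (sym (+-identityʳ s))) 1)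
    (trans (count-cong N (λ g → Q? (s + suc (toℕ g))) (λ g → Q? (suc s + toℕ g))
              (λ g → subst Q (+-suc s (toℕ g))) (λ g → subst Q (sym (+-suc s (toℕ g)))))
           (count-toℕ (suc s) N))

  countFrom-+ : ∀ s M N → countFrom Q? s (M + N) ≡ countFrom Q? s M + countFrom Q? (s + M) N
  countFrom-+ s zero    N = cong (λ z → countFrom Q? z N) (sym (+-identityʳ s))
  countFrom-+ s (suc M) N = begin
    ifDec (Q? s) 1 + countFrom Q? (suc s) (M + N)
      ≡⟨ cong (ifDec (Q? s) 1 +_) (countFrom-+ (suc s) M N) ⟩
    ifDec (Q? s) 1 + (countFrom Q? (suc s) M + countFrom Q? (suc s + M) N)
      ≡⟨ cong (λ z → ifDec (Q? s) 1 + (countFrom Q? (suc s) M + countFrom Q? z N)) (sym (+-suc s M)) ⟩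
    ifDec (Q? s) 1 + (countFrom Q? (suc s) M + countFrom Q? (s + suc M) N)
      ≡⟨ +-assoc (ifDec (Q? s) 1) _ _ ⟨
    countFrom Q? s (suc M) + countFrom Q? (s + suc M) N ∎
    where open ≡-Reasoning

  private
    shrink : ∀ {s N} {R : ℕ → Set} → (∀ j → s ≤ j → j < s + suc N → R j) → ∀ j → suc s ≤ j → j < suc s + N → R j
    shrink {s} {N} on-range j s<j j<s+N = on-range j (<⇒≤ s<j) (subst (j <_) (sym (+-suc s N)) j<s+N)

    first : ∀ {s N} {R : ℕ → Set} → (∀ j → s ≤ j → j < s + suc N → R j) → R s
    first {s} {N} on-range = on-range s ≤-refl (subst (s <_) (sym (+-suc s N)) (s≤s (m≤m+n s N)))

  countFrom-all : ∀ s N → (∀ j → s ≤ j → j < s + N → Q j) → countFrom Q? s N ≡ N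
  countFrom-all s zero    _ = refl
  countFrom-all s (suc N) all with Q? s
  ... | yes _  = cong suc (countFrom-all (suc s) N (shrink all))
  ... | no ¬q = ⊥-elim (¬q (first all))

  countFrom-none : ∀ s N → (∀ j → s ≤ j → j < s + N → ¬ Q j) → countFrom Q? s N ≡ 0
  countFrom-none s zero    _ = refl
  countFrom-none s (suc N) none with Q? s
  ... | yes q = ⊥-elim (first none q)
  ... | no _  = countFrom-none (suc s) N (shrink none)

module _ {X : Set} where

  sum-map-++ : ∀ (w : X → ℕ) xs ys → sum (map w (xs ++ ys)) ≡ sum (map w xs) + sum (map w ys)
  sum-map-++ w xs ys = trans (cong sum (map-++ w xs ys)) (sum-++ (map w xs) (map w ys))

  sum-map-const : ∀ c (xs : List X) → sum (map (λ _ → c) xs) ≡ c * length xs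
  sum-map-const c []       = sym (*-zeroʳ c)
  sum-map-const c (x ∷ xs) = trans (cong (c +_) (sum-map-const c xs)) (sym (*-suc c (length xs)))

  length≡sum-map-1 : ∀ (xs : List X) → length xs ≡ sum (map (λ _ → 1) xs)
  length≡sum-map-1 xs = trans (sym (*-identityˡ (length xs))) (sym (sum-map-const 1 xs))

  sum-map-cong-∈ : ∀ (w w′ : X → ℕ) xs → (∀ x → x ∈ xs → w x ≡ w′ x) → sum (map w xs) ≡ sum (map w′ xs)
  sum-map-cong-∈ w w′ xs w≡w′ = cong sum (map-cong-local (All.tabulate (w≡w′ _)))

  sum-map-affine : ∀ (W f : X → ℕ) K M xs → (∀ x → x ∈ xs → W x + K ≡ M * f x) →
    sum (map W xs) + K * length xs ≡ M * sum (map f xs)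
  sum-map-affine W f K M []       _      = trans (*-zeroʳ K) (sym (*-zeroʳ M))
  sum-map-affine W f K M (x ∷ xs) affine = begin
    W x + sum (map W xs) + K * suc (length xs)      ≡⟨ regroup (W x) _ K _ ⟩
    (W x + K) + (sum (map W xs) + K * length xs)    ≡⟨ cong₂ _+_ (affine x (here refl))
                                                        (sum-map-affine W f K M xs (λ y y∈ → affine y (there y∈))) ⟩
    M * f x + M * sum (map f xs)                     ≡⟨ *-distribˡ-+ M (f x) _ ⟨
    M * sum (map f (x ∷ xs))                         ∎
    where
      open ≡-Reasoning
      open +-*-Solver
      regroup : ∀ a b c d → a + b + c * suc d ≡ (a + c) + (b + c * d)
      regroup = solve 4 (λ a b c d → a :+ b :+ c :* (con 1 :+ d) := (a :+ c) :+ (b :+ c :* d)) refl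

  sum-map-filter-tabulate : ∀ {P : X → Set} N (f : Fin N → X) (P? : ∀ x → Dec (P x)) (w : X → ℕ) →
    sum (map w (filter P? (tabulate f))) ≡ weightedCount N (P? ∘ f) (w ∘ f)
  sum-map-filter-tabulate zero    f P? w = refl
  sum-map-filter-tabulate (suc N) f P? w with P? (f fz)
  ... | yes _ = cong (w (f fz) +_) (sum-map-filter-tabulate N (f ∘ fs) P? w)
  ... | no  _ = sum-map-filter-tabulate N (f ∘ fs) P? w

unique-same-members⇒≡length : ∀ {X : Set} {xs ys : List X} → Unique xs → Unique ys →
  (∀ x → x ∈ xs ⇔ x ∈ ys) → length xs ≡ length ys
unique-same-members⇒≡length xs! ys! same = ↭-length (∼bag⇒↭ (unique∧set⇒bag xs! ys! (λ {x} → same x)))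

module Children {n : ℕ} (targets : List (Perm (suc n))) where

  active? : (σ : Perm n) (g : Fin (suc n)) → Dec (insertMax σ g ∈ targets)
  active? σ g = ∈?[ ≡-dec F._≟_ ] (insertMax σ g) targets

  activeGaps : Perm n → List (Fin (suc n))
  activeGaps σ = filter (active? σ) (allFin (suc n))

  children : List (Perm n) → List (Perm (suc n))
  children []       = []
  children (σ ∷ σs) = map (insertMax σ) (activeGaps σ) ++ children σs

  ∈-children⁻ : ∀ σs {τ} → τ ∈ children σs →
    ∃ λ σ → ∃ λ g → σ ∈ σs × insertMax σ g ∈ targets × τ ≡ insertMax σ g
  ∈-children⁻ (σ ∷ σs) τ∈ with ∈-++⁻ (map (insertMax σ) (activeGaps σ)) τ∈
  ... | inj₁ τ∈σ with ∈-map⁻ (insertMax σ) τ∈σ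
  ...   | g , g∈ , refl = σ , g , here refl , proj₂ (∈-filter⁻ (active? σ) g∈) , refl
  ∈-children⁻ (σ ∷ σs) τ∈ | inj₂ τ∈σs with ∈-children⁻ σs τ∈σs
  ...   | σ′ , g , σ′∈ , active , eq = σ′ , g , there σ′∈ , active , eq

  ∈-children⁺ : ∀ σs {σ} g → σ ∈ σs → insertMax σ g ∈ targets → insertMax σ g ∈ children σs
  ∈-children⁺ (σ ∷ σs)  g (here refl) active =
    ∈-++⁺ˡ (∈-map⁺ (insertMax σ) (∈-filter⁺ (active? σ) (∈-allFin g) active))
  ∈-children⁺ (σ′ ∷ σs) g (there σ∈) active = ∈-++⁺ʳ (map (insertMax σ′) (activeGaps σ′)) (∈-children⁺ σs g σ∈ active)

  children-unique : ∀ σs → Unique σs → Unique (children σs)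
  children-unique []       _            = []
  children-unique (σ ∷ σs) (σ∉ ∷ σs!) = Unique.++⁺
    (Unique.map⁺ (λ eq → proj₂ (insertMax-injective σ σ _ _ eq))
      (Unique.filter⁺ (active? σ) (Unique.allFin⁺ (suc n))))
    (children-unique σs σs!) disjoint
    where
      disjoint : ∀ {τ} → ¬ (τ ∈ map (insertMax σ) (activeGaps σ) × τ ∈ children σs)
      disjoint (τ∈σ , τ∈σs) with ∈-map⁻ (insertMax σ) τ∈σ | ∈-children⁻ σs τ∈σs
      ... | g , _ , refl | σ′ , g′ , σ′∈ , _ , eq = All.lookup σ∉ σ′∈ (proj₁ (insertMax-injective σ σ′ g g′ eq))

  sum-map-children : ∀ (w : Perm (suc n) → ℕ) σs →
    sum (map w (children σs)) ≡ sum (map (λ σ → weightedCount (suc n) (active? σ) (w ∘ insertMax σ)) σs)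
  sum-map-children w []       = refl
  sum-map-children w (σ ∷ σs) = trans (sum-map-++ w (map (insertMax σ) (activeGaps σ)) (children σs))
    (cong₂ _+_ (trans (cong sum (sym (map-∘ (activeGaps σ))))
                      (sum-map-filter-tabulate (suc n) (λ g → g) (active? σ) (w ∘ insertMax σ)))
               (sum-map-children w σs))

  length-children : ∀ σs → length (children σs) ≡ sum (map (λ σ → count (suc n) (active? σ)) σs)
  length-children σs = trans (length≡sum-map-1 (children σs)) (sum-map-children (λ _ → 1) σs)

-- The pattern with A = {i, i + 2}

shiftFrom : ℕ → ℕ → ℕ → ℕ
shiftFrom s δ j = ifDec (s ≤? j) δ

shiftFrom-mono : ∀ s δ {i j} → i ≤ j → shiftFrom s δ i ≤ shiftFrom s δ j
shiftFrom-mono s δ {i} {j} i≤j with s ≤? i | s ≤? j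
... | yes _   | yes _   = ≤-refl
... | yes s≤i | no  s≰j = ⊥-elim (s≰j (≤-trans s≤i i≤j))
... | no  _   | _       = z≤n

shiftFrom-≥ : ∀ s δ {j} → s ≤ j → shiftFrom s δ j ≡ δ
shiftFrom-≥ s δ {j} s≤j with s ≤? j
... | yes _   = refl
... | no  s≰j = ⊥-elim (s≰j s≤j)

shiftFrom-< : ∀ s δ {j} → j < s → shiftFrom s δ j ≡ 0
shiftFrom-< s δ {j} j<s with s ≤? j
... | yes s≤j = ⊥-elim (<⇒≱ j<s s≤j)
... | no  _   = refl

module Spread (l δ₁ δ₂ : ℕ) where

  spread : ℕ → ℕ
  spread j = j + shiftFrom l δ₁ j + shiftFrom (suc (suc l)) δ₂ j

  spread-inc : ∀ {i j} → i < j → spread i < spread j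
  spread-inc i<j = +-mono-<-≤ (+-mono-<-≤ i<j (shiftFrom-mono l δ₁ (<⇒≤ i<j))) (shiftFrom-mono _ δ₂ (<⇒≤ i<j))

  spread-at-l : spread l ≡ l + δ₁
  spread-at-l = trans (cong₂ (λ u v → l + u + v) (shiftFrom-≥ l δ₁ ≤-refl) (shiftFrom-< _ δ₂ (<-trans (n<1+n l) (n<1+n _))))
                      (+-identityʳ _)

  spread-≥l+2 : ∀ {j} → suc (suc l) ≤ j → spread j ≡ j + δ₁ + δ₂
  spread-≥l+2 l+2≤j = cong₂ (λ u v → _ + u + v) (shiftFrom-≥ l δ₁ (≤-trans (n≤1+n l) (≤-trans (n≤1+n _) l+2≤j)))
                        (shiftFrom-≥ _ δ₂ l+2≤j)

module Pattern (l r : ℕ) where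

  k : ℕ
  k = suc (suc (suc (l + r)))

  A : Fin k → Set
  A = A-i-i+2 k (suc l)

  Occ : (n : ℕ) → Perm n → Set
  Occ = Occurrence k A

  Avoider : (n : ℕ) → Perm n → Set
  Avoider n π = IsPerm n π × Avoids k A n π

  -- No occurrence can place a letter of A at a dead position j of a permutation of
  -- length N: fewer than l positions precede j, or fewer than r follow it.
  Dead : ℕ → ℕ → Set
  Dead N j = j < l ⊎ N ≤ j + r

  dead? : ∀ N j → Dec (Dead N j)
  dead? N j with j <? l | N ≤? j + r
  ... | yes j<l | _        = yes (inj₁ j<l)
  ... | no _    | yes N≤j+r = yes (inj₂ N≤j+r)
  ... | no j≮l  | no N≰j+r  = no λ { (inj₁ j<l) → j≮l j<l ; (inj₂ N≤j+r) → N≰j+r N≤j+r }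

  A? : ∀ a → Dec (A a)
  A? a with toℕ a ≟ l | toℕ a ≟ suc (suc l)
  ... | yes a≡l | _          = yes (inj₁ a≡l)
  ... | no _    | yes a≡l+2  = yes (inj₂ a≡l+2)
  ... | no a≢l  | no a≢l+2   = no λ { (inj₁ a≡l) → a≢l a≡l ; (inj₂ a≡l+2) → a≢l+2 a≡l+2 }

  l<k : l < k
  l<k = s≤s (≤-trans (m≤m+n l r) (≤-trans (n≤1+n _) (n≤1+n _)))

  l+1<k : suc l < k
  l+1<k = s≤s (s≤s (≤-trans (m≤m+n l r) (n≤1+n _)))

  l+2<k : suc (suc l) < k
  l+2<k = s≤s (s≤s (s≤s (m≤m+n l r)))

  A-bounds : ∀ a → A a → l ≤ toℕ a × toℕ a + r < k
  A-bounds a (inj₁ a≡l) =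
    ≤-reflexive (sym a≡l) , subst (λ m → m + r < k) (sym a≡l) (s≤s (≤-trans (n≤1+n _) (n≤1+n _)))
  A-bounds a (inj₂ a≡l+2) =
    subst (l ≤_) (sym a≡l+2) (≤-trans (n≤1+n l) (n≤1+n _)) , subst (λ m → m + r < k) (sym a≡l+2) ≤-refl

  lA mA rA : Fin k
  lA = fromℕ< l<k
  mA = fromℕ< l+1<k
  rA = fromℕ< l+2<k

  lA∈A : A lA
  lA∈A = inj₁ (FP.toℕ-fromℕ< l<k)

  rA∈A : A rA
  rA∈A = inj₂ (FP.toℕ-fromℕ< l+2<k)

  lA<rA : lA F.< rA
  lA<rA = subst₂ _<_ (sym (FP.toℕ-fromℕ< l<k)) (sym (FP.toℕ-fromℕ< l+2<k)) (<-trans (n<1+n l) (n<1+n _))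

  A<A⇒around-mA : ∀ a b → A a → A b → a F.< b → a F.< mA × mA F.< b
  A<A⇒around-mA a b (inj₁ a≡l) (inj₁ b≡l) a<b = ⊥-elim (<-irrefl (trans a≡l (sym b≡l)) a<b)
  A<A⇒around-mA a b (inj₁ a≡l) (inj₂ b≡l+2) a<b =
    subst₂ _<_ (sym a≡l) (sym (FP.toℕ-fromℕ< l+1<k)) (n<1+n l) ,
    subst₂ _<_ (sym (FP.toℕ-fromℕ< l+1<k)) (sym b≡l+2) (n<1+n (suc l))
  A<A⇒around-mA a b (inj₂ a≡l+2) (inj₁ b≡l) a<b =
    ⊥-elim (<-asym (subst₂ _<_ a≡l+2 b≡l a<b) (≤-trans (n<1+n l) (n≤1+n _)))
  A<A⇒around-mA a b (inj₂ a≡l+2) (inj₂ b≡l+2) a<b = ⊥-elim (<-irrefl (trans a≡l+2 (sym b≡l+2)) a<b)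

  module _ {N : ℕ} (π : Perm N) (π-inj : IsPerm N π) (o : Occ N π) where

    private
      ι = proj₁ o
      inc = proj₁ (proj₂ o)
      val = proj₂ (proj₂ o)

    A-letter-live : ∀ a → A a → ¬ Dead N (toℕ (ι a))
    A-letter-live a Aa (inj₁ ιa<l) = <⇒≱ ιa<l (≤-trans (proj₁ (A-bounds a Aa)) (increasing⇒≥ ι inc a))
    A-letter-live a Aa (inj₂ N≤ιa+r) = <⇒≱ (increasing⇒room ι inc r a (proj₂ (A-bounds a Aa))) N≤ιa+r

    -- Both letters of A lie above a letter outside A, so only they can carry the two largest values.
    top-two-letter∈A : ∀ b → N ≤ suc (suc (toℕ (lookup π (ι b)))) → A b
    top-two-letter∈A b top with A? b
    ... | yes Ab = Ab
    ... | no ¬Ab = ⊥-elim (<-irrefl (cong toℕ (π-inj _ _ ιlA≡ιrA)) (inc lA rA lA<rA))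
      where
        ιlA≡ιrA : lookup π (ι lA) ≡ lookup π (ι rA)
        ιlA≡ιrA = FP.toℕ-injective
          (squeeze top (val lA b lA∈A ¬Ab) (FP.toℕ<n _) (val rA b rA∈A ¬Ab) (FP.toℕ<n _))

    dead-top-two-unused : ∀ q → Dead N (toℕ q) → N ≤ suc (suc (toℕ (lookup π q))) → ∀ a → ι a ≢ q
    dead-top-two-unused q dead top a refl = A-letter-live a (top-two-letter∈A a top) dead

    private
      A-letters-not-successive : ∀ a b → A a → A b → toℕ (ι b) ≢ suc (toℕ (ι a))
      A-letters-not-successive a b Aa Ab adj with FP.<-cmp a b
      ... | tri≈ _ refl _ = 1+n≢n (sym adj)
      ... | tri> _ _ b<a  = <-asym (inc b a b<a) (subst (toℕ (ι a) <_) (sym adj) (n<1+n _))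
      ... | tri< a<b _ _  with A<A⇒around-mA a b Aa Ab a<b
      ...   | a<mA , mA<b = <⇒≱ (inc mA b mA<b) (subst (_≤ toℕ (ι mA)) (sym adj) (inc a mA a<mA))

    A-letters-not-adjacent : ∀ a b → A a → A b → ¬ Adjacent (ι a) (ι b)
    A-letters-not-adjacent a b Aa Ab (inj₁ b≡a+1) = A-letters-not-successive a b Aa Ab b≡a+1
    A-letters-not-adjacent a b Aa Ab (inj₂ a≡b+1) = A-letters-not-successive b a Ab Aa a≡b+1

  avoids-short : ∀ {N} → N < k → (π : Perm N) → Avoids k A N π
  avoids-short {N} N<k π (ι , inc , _) = <⇒≱ (≤-<-trans last≤ι (FP.toℕ<n (ι last))) (≤-pred N<k)
    where
      last : Fin k
      last = F.fromℕ (suc (suc (l + r)))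
      last≤ι : suc (suc (l + r)) ≤ toℕ (ι last)
      last≤ι = subst (_≤ toℕ (ι last)) (FP.toℕ-fromℕ _) (increasing⇒≥ ι inc last)

  insertMax-dead-avoids : ∀ {n} (σ : Perm n) g → IsPerm n σ → Avoids k A n σ →
    Dead (suc n) (toℕ g) → Avoids k A (suc n) (insertMax σ g)
  insertMax-dead-avoids {n} σ g σ-inj σ-avoids dead o =
    σ-avoids (occurrence-punchOut A (insertMax-deletion σ g) o
      (dead-top-two-unused (insertMax σ g) (insertMax-isPerm σ g σ-inj) o g dead top))
    where
      top : suc n ≤ suc (suc (toℕ (lookup (insertMax σ g) g)))
      top = subst (λ m → suc n ≤ suc (suc m)) (sym (toℕ-insertMax-pivot σ g)) (n≤1+n _)

  insertMax²-avoids⇔ : ∀ {n} (σ : Perm n) → Avoider n σ → ∀ d → Dead (suc n) (toℕ d) → ∀ h y →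
    punchIn (punchIn h d) y ≡ h →
    (∀ w → punchIn (punchIn h d) (punchIn y w) ≡ punchIn h (punchIn d w)) →
    Dead (suc (suc n)) (toℕ (punchIn h d)) ⊎ (Dead (suc (suc n)) (toℕ h) × Dead (suc n) (toℕ y)) →
    Avoids k A (suc (suc n)) (insertMax (insertMax σ d) h) ⇔ Avoids k A (suc n) (insertMax σ y)
  insertMax²-avoids⇔ {n} σ (σ-inj , σ-avoids) d d-dead h y pivot-lines-up punchIn-lines-up (inj₁ q-dead) =
    mk⇔ (deletion-avoids A del) (λ ρ-avoids o → ρ-avoids (occurrence-punchOut A del o
      (dead-top-two-unused π (insertMax-isPerm τ h (insertMax-isPerm σ d σ-inj)) o (punchIn h d) q-dead top)))
    where
      τ = insertMax σ d
      π = insertMax τ h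
      del = insertMax²-deletion σ d h y pivot-lines-up punchIn-lines-up
      top : suc (suc n) ≤ suc (suc (toℕ (lookup π (punchIn h d))))
      top = ≤-reflexive (cong (suc ∘ suc) (sym (toℕ-insertMax²-old-pivot σ d h)))
  insertMax²-avoids⇔ σ (σ-inj , σ-avoids) d d-dead h y _ _ (inj₂ (h-dead , y-dead)) =
    mk⇔ (λ _ → insertMax-dead-avoids σ y σ-inj σ-avoids y-dead)
        (λ _ → insertMax-dead-avoids (insertMax σ d) h (insertMax-isPerm σ d σ-inj)
                 (insertMax-dead-avoids σ d σ-inj σ-avoids d-dead) h-dead)

  dead-grandchild-positions : ∀ {n} (d y : Fin (suc n)) → Dead (suc n) (toℕ d) →
    let h = punchIn (inject₁ d) y in
    Dead (suc (suc n)) (toℕ (punchIn h d)) ⊎ (Dead (suc (suc n)) (toℕ h) × Dead (suc n) (toℕ y))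
  dead-grandchild-positions d y d-dead with toℕ y <? toℕ d
  ... | yes y<d = cases d-dead
    where
      h≡y : toℕ (punchIn (inject₁ d) y) ≡ toℕ y
      h≡y = toℕ-punchIn-< (inject₁ d) y (subst (toℕ y <_) (sym (FP.toℕ-inject₁ d)) y<d)
      q≡d+1 : toℕ (punchIn (punchIn (inject₁ d) y) d) ≡ suc (toℕ d)
      q≡d+1 = toℕ-punchIn-≥ _ d (subst (_≤ toℕ d) (sym h≡y) (<⇒≤ y<d))
      cases : Dead _ (toℕ d) → _
      cases (inj₁ d<l) with suc (toℕ d) <? l
      ... | yes d+1<l = inj₁ (inj₁ (subst (_< l) (sym q≡d+1) d+1<l))
      ... | no _      = inj₂ (inj₁ (subst (_< l) (sym h≡y) (<-trans y<d d<l)) , inj₁ (<-trans y<d d<l))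
      cases (inj₂ n<d+r) = inj₁ (inj₂ (subst (λ m → _ ≤ m + r) (sym q≡d+1) (s≤s n<d+r)))
  ... | no y≮d = cases d-dead
    where
      d≤y : toℕ d ≤ toℕ y
      d≤y = ≮⇒≥ y≮d
      h≡y+1 : toℕ (punchIn (inject₁ d) y) ≡ suc (toℕ y)
      h≡y+1 = toℕ-punchIn-≥ (inject₁ d) y (subst (_≤ toℕ y) (sym (FP.toℕ-inject₁ d)) d≤y)
      q≡d : toℕ (punchIn (punchIn (inject₁ d) y) d) ≡ toℕ d
      q≡d = toℕ-punchIn-< _ d (subst (toℕ d <_) (sym h≡y+1) (s≤s d≤y))
      cases : Dead _ (toℕ d) → _
      cases (inj₁ d<l) = inj₁ (inj₁ (subst (_< l) (sym q≡d) d<l))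
      cases (inj₂ n<d+r) = inj₂ (inj₂ (subst (λ m → _ ≤ m + r) (sym h≡y+1) (s≤s y-dead)) , inj₂ y-dead)
        where y-dead = ≤-trans n<d+r (+-monoˡ-≤ r d≤y)

  dead-child-avoids⇔ : ∀ {n} (σ : Perm n) → Avoider n σ → ∀ d → Dead (suc n) (toℕ d) → ∀ y →
    Avoids k A (suc (suc n)) (insertMax (insertMax σ d) (punchIn (inject₁ d) y)) ⇔ Avoids k A (suc n) (insertMax σ y)
  dead-child-avoids⇔ σ σ-avoider d d-dead y =
    insertMax²-avoids⇔ σ σ-avoider d d-dead (punchIn (inject₁ d) y) y
      (punchIn-inject₁-pivot d y) (punchIn-inject₁-punchIn d y) (dead-grandchild-positions d y d-dead)

  module _ {m : ℕ} (π : Perm (suc (suc m))) (π-inj : IsPerm (suc (suc m)) π) (t s : Fin (suc (suc m)))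
    (adj : Adjacent t s) (t-top : toℕ (lookup π t) ≡ suc m) (s-second : toℕ (lookup π s) ≡ m)
    (others-below : ∀ w → w ≢ t → w ≢ s → toℕ (lookup π w) < m) where

    private
      letter-at∈A : (o : Occ _ π) → ∀ a w → proj₁ o a ≡ w → m ≤ toℕ (lookup π w) → A a
      letter-at∈A o a w refl m≤πw = top-two-letter∈A π π-inj o a (s≤s (s≤s m≤πw))

      letter-at-t∈A : (o : Occ _ π) → ∀ a → proj₁ o a ≡ t → A a
      letter-at-t∈A o a ιa≡t = letter-at∈A o a t ιa≡t (subst (m ≤_) (sym t-top) (n≤1+n m))

      letter-at-s∈A : (o : Occ _ π) → ∀ a → proj₁ o a ≡ s → A a
      letter-at-s∈A o a ιa≡s = letter-at∈A o a s ιa≡s (≤-reflexive (sym s-second))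

      redirect : Fin (suc (suc m)) → Fin (suc (suc m))
      redirect x with x F.≟ t
      ... | yes _ = s
      ... | no  _ = x

      redirect-t : ∀ x → x ≡ t → redirect x ≡ s
      redirect-t x x≡t with x F.≟ t
      ... | yes _   = refl
      ... | no x≢t = ⊥-elim (x≢t x≡t)

      redirect-id : ∀ x → x ≢ t → redirect x ≡ x
      redirect-id x x≢t with x F.≟ t
      ... | yes x≡t = ⊥-elim (x≢t x≡t)
      ... | no _    = refl

      redirect≢t : ∀ x → redirect x ≢ t
      redirect≢t x with x F.≟ t
      ... | yes _   = adjacent⇒≢ adj
      ... | no x≢t = x≢t

      redirect-mono : ∀ x y → x ≢ s → y ≢ s → x F.< y → redirect x F.< redirect y
      redirect-mono x y x≢s y≢s x<y with x F.≟ t | y F.≟ t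
      ... | yes refl | yes refl = ⊥-elim (<-irrefl refl x<y)
      ... | yes refl | no _     = adjacent-above adj x<y y≢s
      ... | no _     | yes refl = adjacent-below adj x<y x≢s
      ... | no _     | no _     = x<y

    -- An occurrence through the maximum t can use the adjacent entry s instead, unless it
    -- already uses both; but then both carry letters of A, which are never adjacent.
    occurrence-avoiding-top : Occ _ π → Σ (Occ _ π) λ o → ∀ a → proj₁ o a ≢ t
    occurrence-avoiding-top o@(ι , inc , val) with FP.any? (λ a → ι a F.≟ t)
    ... | no t-unused = o , λ a ιa≡t → t-unused (a , ιa≡t)
    ... | yes (a₀ , ιa₀≡t) with FP.any? (λ b → ι b F.≟ s)
    ...   | yes (b₀ , ιb₀≡s) = ⊥-elim (A-letters-not-adjacent π π-inj o a₀ b₀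
              (letter-at-t∈A o a₀ ιa₀≡t) (letter-at-s∈A o b₀ ιb₀≡s) (subst₂ Adjacent (sym ιa₀≡t) (sym ιb₀≡s) adj))
    ...   | no s-unused = ((λ a → redirect (ι a)) , inc′ , val′) , λ a → redirect≢t (ι a)
      where
        ι≢s : ∀ a → ι a ≢ s
        ι≢s a ιa≡s = s-unused (a , ιa≡s)
        inc′ : StrictlyIncreasing (λ a → redirect (ι a))
        inc′ a b a<b = redirect-mono (ι a) (ι b) (ι≢s a) (ι≢s b) (inc a b a<b)
        val′ : ∀ a b → A a → ¬ A b → lookup π (redirect (ι b)) F.< lookup π (redirect (ι a))
        val′ a b Aa ¬Ab = subst (λ z → toℕ (lookup π z) < toℕ (lookup π (redirect (ι a))))
            (sym (redirect-id (ι b) ιb≢t)) (by-cases (ι a F.≟ t))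
          where
            ιb≢t : ι b ≢ t
            ιb≢t ιb≡t = ¬Ab (letter-at-t∈A o b ιb≡t)
            by-cases : Dec (ι a ≡ t) → toℕ (lookup π (ι b)) < toℕ (lookup π (redirect (ι a)))
            by-cases (yes ιa≡t) = subst (λ z → toℕ (lookup π (ι b)) < toℕ (lookup π z)) (sym (redirect-t (ι a) ιa≡t))
              (subst (_ <_) (sym s-second) (others-below (ι b) ιb≢t (ι≢s b)))
            by-cases (no ιa≢t) = subst (λ z → toℕ (lookup π (ι b)) < toℕ (lookup π z)) (sym (redirect-id (ι a) ιa≢t))
              (val a b Aa ¬Ab)

  adjacent-insertMax-avoids : ∀ {n} (σ : Perm n) g → IsPerm n σ → Avoids k A (suc n) (insertMax σ g) →
    ∀ h → Adjacent h (punchIn h g) → Avoids k A (suc (suc n)) (insertMax (insertMax σ g) h)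
  adjacent-insertMax-avoids σ g σ-inj τ-avoids h adj o =
    τ-avoids (occurrence-punchOut A (insertMax-deletion τ h) (proj₁ rerouted) (proj₂ rerouted))
    where
      τ = insertMax σ g
      rerouted = occurrence-avoiding-top (insertMax τ h) (insertMax-isPerm τ h (insertMax-isPerm σ g σ-inj))
        h (punchIn h g) adj (toℕ-insertMax-pivot τ h) (toℕ-insertMax²-old-pivot σ g h) (insertMax²-others<n σ g h) o

  occurrence-along : ∀ {L} (π : Perm L) (φ : ℕ → ℕ) → (∀ {i j} → i < j → φ i < φ j) →
    φ (suc (suc (l + r))) < L → (x y : Fin L) → toℕ x ≡ φ l → toℕ y ≡ φ (suc (suc l)) →
    (∀ w → w ≢ x → w ≢ y → lookup π w F.< lookup π x × lookup π w F.< lookup π y) → Occ L π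
  occurrence-along {L} π φ φ-inc φ-last<L x y x≡φl y≡φl+2 others-below = ι , inc , val
    where
      φ-mono : ∀ {i j} → i ≤ j → φ i ≤ φ j
      φ-mono i≤j with m≤n⇒m<n∨m≡n i≤j
      ... | inj₁ i<j  = <⇒≤ (φ-inc i<j)
      ... | inj₂ refl = ≤-refl

      φ-injective : ∀ {i j} → φ i ≡ φ j → i ≡ j
      φ-injective {i} {j} eq with <-cmp i j
      ... | tri< i<j _ _ = ⊥-elim (<-irrefl eq (φ-inc i<j))
      ... | tri≈ _ i≡j _ = i≡j
      ... | tri> _ _ j<i = ⊥-elim (<-irrefl (sym eq) (φ-inc j<i))

      ι : Fin k → Fin L
      ι a = fromℕ< (≤-<-trans (φ-mono (≤-pred (FP.toℕ<n a))) φ-last<L)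

      toℕ-ι : ∀ a → toℕ (ι a) ≡ φ (toℕ a)
      toℕ-ι a = FP.toℕ-fromℕ< _

      inc : StrictlyIncreasing ι
      inc a b a<b = subst₂ _<_ (sym (toℕ-ι a)) (sym (toℕ-ι b)) (φ-inc a<b)

      A-at-x-or-y : ∀ a → A a → ι a ≡ x ⊎ ι a ≡ y
      A-at-x-or-y a (inj₁ a≡l)   = inj₁ (FP.toℕ-injective (trans (toℕ-ι a) (trans (cong φ a≡l) (sym x≡φl))))
      A-at-x-or-y a (inj₂ a≡l+2) = inj₂ (FP.toℕ-injective (trans (toℕ-ι a) (trans (cong φ a≡l+2) (sym y≡φl+2))))

      at-x⇒A : ∀ b → ι b ≡ x → A b
      at-x⇒A b ιb≡x = inj₁ (φ-injective (trans (sym (toℕ-ι b)) (trans (cong toℕ ιb≡x) x≡φl)))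

      at-y⇒A : ∀ b → ι b ≡ y → A b
      at-y⇒A b ιb≡y = inj₂ (φ-injective (trans (sym (toℕ-ι b)) (trans (cong toℕ ιb≡y) y≡φl+2)))

      val : ∀ a b → A a → ¬ A b → lookup π (ι b) F.< lookup π (ι a)
      val a b Aa ¬Ab with A-at-x-or-y a Aa | others-below (ι b) (¬Ab ∘ at-x⇒A b) (¬Ab ∘ at-y⇒A b)
      ... | inj₁ ιa≡x | below-x , _ = subst (λ z → lookup π (ι b) F.< lookup π z) (sym ιa≡x) below-x
      ... | inj₂ ιa≡y | _ , below-y = subst (λ z → lookup π (ι b) F.< lookup π z) (sym ιa≡y) below-y

  -- The letters before l stay in place, the letter l + 1 goes right after x, and the last r
  -- letters right after y.
  occurrence-through : ∀ {L} (π : Perm L) (x y : Fin L) → l ≤ toℕ x → suc (toℕ x) < toℕ y → toℕ y + r < L →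
    (∀ w → w ≢ x → w ≢ y → lookup π w F.< lookup π x × lookup π w F.< lookup π y) → Occ L π
  occurrence-through {L} π x y l≤x x+1<y y+r<L =
    occurrence-along π spread spread-inc (subst (_< L) (sym spread-last≡y+r) y+r<L) x y
      (trans (sym x≡l+δ₁) (sym spread-at-l)) (trans (sym y≡l+2+δ₁+δ₂) (sym (spread-≥l+2 ≤-refl)))
    where
      δ₁ = toℕ x ∸ l
      δ₂ = toℕ y ∸ suc (suc (toℕ x))
      open Spread l δ₁ δ₂

      x≡l+δ₁ : l + δ₁ ≡ toℕ x
      x≡l+δ₁ = m+[n∸m]≡n l≤x

      y≡l+2+δ₁+δ₂ : suc (suc (l + δ₁)) + δ₂ ≡ toℕ y
      y≡l+2+δ₁+δ₂ = trans (cong (λ z → suc (suc z) + δ₂) x≡l+δ₁) (m+[n∸m]≡n x+1<y)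

      spread-last≡y+r : spread (suc (suc (l + r))) ≡ toℕ y + r
      spread-last≡y+r = begin
        spread (suc (suc (l + r)))    ≡⟨ spread-≥l+2 (s≤s (s≤s (m≤m+n l r))) ⟩
        suc (suc (l + r)) + δ₁ + δ₂   ≡⟨ rearrange l r δ₁ δ₂ ⟩
        suc (suc (l + δ₁)) + δ₂ + r   ≡⟨ cong (_+ r) y≡l+2+δ₁+δ₂ ⟩
        toℕ y + r                     ∎
        where
          open ≡-Reasoning
          open +-*-Solver
          rearrange : ∀ l r a b → suc (suc (l + r)) + a + b ≡ suc (suc (l + a)) + b + r
          rearrange = solve 4 (λ l r a b → con 2 :+ (l :+ r) :+ a :+ b := con 2 :+ (l :+ a) :+ b :+ r) refl

  live-nonadjacent-occurrence : ∀ {n} (σ : Perm n) g → ¬ Dead (suc n) (toℕ g) → ∀ h →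
    h ≢ inject₁ g → h ≢ fs g → ¬ Dead (suc (suc n)) (toℕ h) → Occ (suc (suc n)) (insertMax (insertMax σ g) h)
  live-nonadjacent-occurrence σ g g-live h h≢g h≢g+1 h-live with toℕ h ≤? toℕ g
  ... | yes h≤g = occurrence-through π h q (≮⇒≥ (h-live ∘ inj₁)) h+1<q q+r<N
                    (insertMax²-others-below σ g h)
    where
      π = insertMax (insertMax σ g) h
      q = punchIn h g
      q≡g+1 : toℕ q ≡ suc (toℕ g)
      q≡g+1 = toℕ-punchIn-≥ h g h≤g
      h+1<q : suc (toℕ h) < toℕ q
      h+1<q = subst (suc (toℕ h) <_) (sym q≡g+1)
        (s≤s (≤∧≢⇒< h≤g (λ h≡g → h≢g (FP.toℕ-injective (trans h≡g (sym (FP.toℕ-inject₁ g)))))))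
      q+r<N : toℕ q + r < _
      q+r<N = subst (λ m → m + r < _) (sym q≡g+1) (s≤s (≰⇒> (g-live ∘ inj₂)))
  ... | no h≰g = occurrence-through π q h (subst (l ≤_) (sym q≡g) (≮⇒≥ (g-live ∘ inj₁))) q+1<h (≰⇒> (h-live ∘ inj₂))
                   (λ w w≢q w≢h → swap (insertMax²-others-below σ g h w w≢h w≢q))
    where
      π = insertMax (insertMax σ g) h
      q = punchIn h g
      g<h : toℕ g < toℕ h
      g<h = ≰⇒> h≰g
      q≡g : toℕ q ≡ toℕ g
      q≡g = toℕ-punchIn-< h g g<h
      q+1<h : suc (toℕ q) < toℕ h
      q+1<h = subst (λ m → suc m < toℕ h) (sym q≡g) (≤∧≢⇒< g<h (λ g+1≡h → h≢g+1 (FP.toℕ-injective (sym g+1≡h))))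


  dead-count : ∀ N → l + r ≤ N → count N (λ g → dead? N (toℕ g)) ≡ l + r
  dead-count N l+r≤N with m≤n⇒∃[o]m+o≡n l+r≤N
  ... | middle , l+r+m≡N = begin
    count N (λ g → dead? N (0 + toℕ g))               ≡⟨ count-toℕ (dead? N) 0 N ⟩
    countFrom (dead? N) 0 N                           ≡⟨ cong (countFrom (dead? N) 0) N≡l+m+r ⟩
    countFrom (dead? N) 0 (l + (middle + r))          ≡⟨ countFrom-+ (dead? N) 0 l (middle + r) ⟩
    countFrom (dead? N) 0 l + countFrom (dead? N) l (middle + r)
      ≡⟨ cong (countFrom (dead? N) 0 l +_) (countFrom-+ (dead? N) l middle r) ⟩
    countFrom (dead? N) 0 l + (countFrom (dead? N) l middle + countFrom (dead? N) (l + middle) r)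
      ≡⟨ cong₂ (λ u v → u + (v + countFrom (dead? N) (l + middle) r))
           (countFrom-all (dead? N) 0 l (λ j _ j<l → inj₁ j<l))
           (countFrom-none (dead? N) l middle middle-live) ⟩
    l + countFrom (dead? N) (l + middle) r
      ≡⟨ cong (l +_) (countFrom-all (dead? N) (l + middle) r right-dead) ⟩
    l + r ∎
    where
      open ≡-Reasoning
      l+m+r≡N : l + middle + r ≡ N
      l+m+r≡N = trans (trans (+-assoc l middle r) (trans (cong (l +_) (+-comm middle r)) (sym (+-assoc l r middle)))) l+r+m≡N
      N≡l+m+r : N ≡ l + (middle + r)
      N≡l+m+r = trans (sym l+m+r≡N) (+-assoc l middle r)
      middle-live : ∀ j → l ≤ j → j < l + middle → ¬ Dead N j
      middle-live j l≤j _        (inj₁ j<l)   = <⇒≱ j<l l≤j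
      middle-live j _   j<l+m    (inj₂ N≤j+r) = <⇒≱ (subst (j + r <_) l+m+r≡N (+-monoˡ-< r j<l+m)) N≤j+r
      right-dead : ∀ j → l + middle ≤ j → j < l + middle + r → Dead N j
      right-dead j l+m≤j _ = inj₂ (subst (_≤ j + r) l+m+r≡N (+-monoˡ-≤ r l+m≤j))

  -- punchIn (inject₁ g) (punchIn g y) is where the entry y of σ ends up after both insertions.
  dead-after-live⇔ : ∀ {n} (g : Fin (suc n)) → ¬ Dead (suc n) (toℕ g) → ∀ (y : Fin n) →
    Dead (suc (suc n)) (toℕ (punchIn (inject₁ g) (punchIn g y))) ⇔ Dead n (toℕ y)
  dead-after-live⇔ {n} g g-live y with toℕ y <? toℕ g
  ... | yes y<g = mk⇔ to from
    where
      y′≡y : toℕ (punchIn (inject₁ g) (punchIn g y)) ≡ toℕ y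
      y′≡y = trans (toℕ-punchIn-< (inject₁ g) (punchIn g y)
                     (subst₂ _<_ (sym (toℕ-punchIn-< g y y<g)) (sym (FP.toℕ-inject₁ g)) y<g))
                   (toℕ-punchIn-< g y y<g)
      y+r<n : toℕ y + r < n
      y+r<n = <-≤-trans (+-monoˡ-< r y<g) (≤-pred (≰⇒> (g-live ∘ inj₂)))
      to : Dead (suc (suc n)) _ → Dead n (toℕ y)
      to dead with subst (Dead (suc (suc n))) y′≡y dead
      ... | inj₁ y<l = inj₁ y<l
      ... | inj₂ n+2≤y+r = ⊥-elim (<⇒≱ y+r<n (≤-trans (≤-trans (n≤1+n n) (n≤1+n _)) n+2≤y+r))
      from : Dead n (toℕ y) → Dead (suc (suc n)) _
      from (inj₁ y<l) = subst (Dead (suc (suc n))) (sym y′≡y) (inj₁ y<l)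
      from (inj₂ n≤y+r) = ⊥-elim (<⇒≱ y+r<n n≤y+r)
  ... | no y≮g = mk⇔ to from
    where
      g≤y : toℕ g ≤ toℕ y
      g≤y = ≮⇒≥ y≮g
      y′≡y+2 : toℕ (punchIn (inject₁ g) (punchIn g y)) ≡ suc (suc (toℕ y))
      y′≡y+2 = trans (toℕ-punchIn-≥ (inject₁ g) (punchIn g y)
                       (subst₂ _≤_ (sym (FP.toℕ-inject₁ g)) (sym (toℕ-punchIn-≥ g y g≤y)) (≤-trans g≤y (n≤1+n _))))
                     (cong suc (toℕ-punchIn-≥ g y g≤y))
      l≤y : l ≤ toℕ y
      l≤y = ≤-trans (≮⇒≥ (g-live ∘ inj₁)) g≤y
      to : Dead (suc (suc n)) _ → Dead n (toℕ y)
      to dead with subst (Dead (suc (suc n))) y′≡y+2 dead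
      ... | inj₁ y+2<l = ⊥-elim (<⇒≱ y+2<l (≤-trans l≤y (≤-trans (n≤1+n _) (n≤1+n _))))
      ... | inj₂ n+2≤y+2+r = inj₂ (≤-pred (≤-pred n+2≤y+2+r))
      from : Dead n (toℕ y) → Dead (suc (suc n)) _
      from (inj₁ y<l) = ⊥-elim (<⇒≱ y<l l≤y)
      from (inj₂ n≤y+r) = subst (Dead (suc (suc n))) (sym y′≡y+2) (inj₂ (s≤s (s≤s n≤y+r)))

-- The recurrence

module Recurrence (l r : ℕ) (a : ℕ → ℕ) (hyp : ∀ n → NumAvoiders (Pattern.k l r) (Pattern.A l r) n (a n)) where

  open Pattern l r

  avoiders : ∀ n → List (Perm n)
  avoiders n = proj₁ (hyp n)

  avoiders-unique : ∀ n → Unique (avoiders n)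
  avoiders-unique n = proj₁ (proj₂ (hyp n))

  length-avoiders : ∀ n → length (avoiders n) ≡ a n
  length-avoiders n = proj₁ (proj₂ (proj₂ (hyp n)))

  ∈-avoiders : ∀ n σ → σ ∈ avoiders n ⇔ Avoider n σ
  ∈-avoiders n = proj₂ (proj₂ (proj₂ (hyp n)))

  ∈-avoiders-insertMax : ∀ {n} (σ : Perm n) g → IsPerm n σ →
    insertMax σ g ∈ avoiders (suc n) ⇔ Avoids k A (suc n) (insertMax σ g)
  ∈-avoiders-insertMax σ g σ-inj = mk⇔ (proj₂ ∘ Equivalence.to (∈-avoiders _ _))
    (λ avoids → Equivalence.from (∈-avoiders _ _) (insertMax-isPerm σ g σ-inj , avoids))

  enumeration-length : ∀ n {σs} → Unique σs → (∀ σ → σ ∈ σs ⇔ Avoider n σ) → a n ≡ length σs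
  enumeration-length n σs! exact = trans (sym (length-avoiders n))
    (unique-same-members⇒≡length (avoiders-unique n) σs! (λ σ → ⇔.trans (∈-avoiders n σ) (⇔.sym (exact σ))))

  module Grow (n : ℕ) {σs : List (Perm n)} (σs! : Unique σs) (exact : ∀ σ → σ ∈ σs ⇔ Avoider n σ) where

    open Children (avoiders (suc n)) public

    grown-unique : Unique (children σs)
    grown-unique = children-unique σs σs!

    grown-exact : ∀ τ → τ ∈ children σs ⇔ Avoider (suc n) τ
    grown-exact τ = mk⇔ to from
      where
        to : τ ∈ children σs → Avoider (suc n) τ
        to τ∈ with ∈-children⁻ σs τ∈
        ... | σ , g , _ , active , refl = Equivalence.to (∈-avoiders (suc n) _) active
        from : Avoider (suc n) τ → τ ∈ children σs
        from (τ-inj , τ-avoids) with insertMax-surjective τ τ-inj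
        ... | σ , g , σ-inj , refl = ∈-children⁺ σs g
          (Equivalence.from (exact σ) (σ-inj , deletion-avoids A (insertMax-deletion σ g) τ-avoids))
          (Equivalence.from (∈-avoiders (suc n) _) (τ-inj , τ-avoids))

    a≡sum-count : a (suc n) ≡ sum (map (λ σ → count (suc n) (active? σ)) σs)
    a≡sum-count = trans (enumeration-length (suc n) grown-unique grown-exact) (length-children σs)

  a0≡1 : a 0 ≡ 1
  a0≡1 = enumeration-length 0 {V.[] ∷ []} (All.[] ∷ []) exact
    where
      only-[] : ∀ (σ : Perm 0) → σ ≡ V.[]
      only-[] V.[] = refl
      exact : ∀ σ → σ ∈ V.[] ∷ [] ⇔ Avoider 0 σ
      exact σ = mk⇔ (λ _ → (λ ()) , avoids-short (s≤s z≤n) σ) (λ _ → here (only-[] σ))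

  a-small : ∀ n → n < k → a n ≡ n !
  a-small zero    _     = a0≡1
  a-small (suc n) n+1<k = begin
    a (suc n)                                                ≡⟨ a≡sum-count ⟩
    sum (map (λ σ → count (suc n) (active? σ)) (avoiders n)) ≡⟨ sum-map-cong-∈ _ _ (avoiders n) all-active ⟩
    sum (map (λ _ → suc n) (avoiders n))                     ≡⟨ sum-map-const (suc n) (avoiders n) ⟩
    suc n * length (avoiders n)                              ≡⟨ cong (suc n *_) (length-avoiders n) ⟩
    suc n * a n                                              ≡⟨ cong (suc n *_) (a-small n (<-trans (n<1+n n) n+1<k)) ⟩
    suc n * n !                                              ∎
    where
      open ≡-Reasoning
      open Grow n (avoiders-unique n) (∈-avoiders n)
      all-active : ∀ σ → σ ∈ avoiders n → count (suc n) (active? σ) ≡ suc n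
      all-active σ σ∈ = count-all (suc n) (active? σ) λ g → Equivalence.from (∈-avoiders-insertMax σ g σ-inj)
          (avoids-short n+1<k (insertMax σ g))
        where σ-inj = proj₁ (Equivalence.to (∈-avoiders n σ) σ∈)

  module Step (n : ℕ) (l+r<n : l + r < n) where

    private
      c = l + r
      module G₁ = Grow n (avoiders-unique n) (∈-avoiders n)
      module G₂ = Grow (suc n) G₁.grown-unique G₁.grown-exact

    childCount : Perm n → ℕ
    childCount σ = count (suc n) (G₁.active? σ)

    grandchildCount : Perm n → Fin (suc n) → ℕ
    grandchildCount σ g = count (suc (suc n)) (G₂.active? (insertMax σ g))

    module _ (σ : Perm n) (σ-inj : IsPerm n σ) (σ-avoids : Avoids k A n σ) where

      dead-grandchildCount : ∀ g → Dead (suc n) (toℕ g) → grandchildCount σ g ≡ suc (childCount σ)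
      dead-grandchildCount g g-dead =
        count-punchIn (suc n) (G₂.active? τ) (G₁.active? σ) (inject₁ g)
          (Equivalence.from (∈-avoiders-insertMax τ _ τ-inj)
            (adjacent-insertMax-avoids σ g σ-inj τ-avoids (inject₁ g) (adjacent-inject₁ g)))
          (λ y active → Equivalence.from (∈-avoiders-insertMax σ y σ-inj)
            (Equivalence.to (dead-child-avoids⇔ σ (σ-inj , σ-avoids) g g-dead y)
              (Equivalence.to (∈-avoiders-insertMax τ _ τ-inj) active)))
          (λ y active → Equivalence.from (∈-avoiders-insertMax τ _ τ-inj)
            (Equivalence.from (dead-child-avoids⇔ σ (σ-inj , σ-avoids) g g-dead y)
              (Equivalence.to (∈-avoiders-insertMax σ y σ-inj) active)))
        where
          τ = insertMax σ g
          τ-inj = insertMax-isPerm σ g σ-inj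
          τ-avoids = insertMax-dead-avoids σ g σ-inj σ-avoids g-dead

      live-grandchildCount : ∀ g → Avoids k A (suc n) (insertMax σ g) → ¬ Dead (suc n) (toℕ g) →
        grandchildCount σ g ≡ suc (suc c)
      live-grandchildCount g τ-avoids g-live = begin
        count (suc (suc n)) P?
          ≡⟨ count-punchIn (suc n) P? (P? ∘ punchIn (inject₁ g)) (inject₁ g)
               (adjacent-active (inject₁ g) (adjacent-inject₁ g)) (λ _ p → p) (λ _ p → p) ⟩
        suc (count (suc n) (P? ∘ punchIn (inject₁ g)))
          ≡⟨ cong suc (count-punchIn n (P? ∘ punchIn (inject₁ g)) (P? ∘ punchIn (inject₁ g) ∘ punchIn g) g
               (subst (λ h → insertMax τ h ∈ _) (sym (punchIn-inject₁-self g)) (adjacent-active (fs g) (adjacent-suc g)))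
               (λ _ p → p) (λ _ p → p)) ⟩
        suc (suc (count n (P? ∘ punchIn (inject₁ g) ∘ punchIn g)))
          ≡⟨ cong (suc ∘ suc) (count-cong n _ (λ y → dead? n (toℕ y)) active⇒dead dead⇒active) ⟩
        suc (suc (count n (λ y → dead? n (toℕ y))))
          ≡⟨ cong (suc ∘ suc) (dead-count n (<⇒≤ l+r<n)) ⟩
        suc (suc c) ∎
        where
          open ≡-Reasoning
          τ = insertMax σ g
          τ-inj = insertMax-isPerm σ g σ-inj
          P? = G₂.active? τ
          adjacent-active : ∀ h → Adjacent h (punchIn h g) → insertMax τ h ∈ avoiders (suc (suc n))
          adjacent-active h adj = Equivalence.from (∈-avoiders-insertMax τ h τ-inj)
            (adjacent-insertMax-avoids σ g σ-inj τ-avoids h adj)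
          active⇒dead : ∀ y → insertMax τ (punchIn (inject₁ g) (punchIn g y)) ∈ avoiders (suc (suc n)) → Dead n (toℕ y)
          active⇒dead y active with dead? (suc (suc n)) (toℕ (punchIn (inject₁ g) (punchIn g y)))
          ... | yes h-dead = Equivalence.to (dead-after-live⇔ g g-live y) h-dead
          ... | no  h-live = ⊥-elim (Equivalence.to (∈-avoiders-insertMax τ _ τ-inj) active
                (live-nonadjacent-occurrence σ g g-live _ (FP.punchInᵢ≢i (inject₁ g) _) h≢g+1 h-live))
            where
              h≢g+1 : punchIn (inject₁ g) (punchIn g y) ≢ fs g
              h≢g+1 eq = FP.punchInᵢ≢i g y
                (FP.punchIn-injective (inject₁ g) _ _ (trans eq (sym (punchIn-inject₁-self g))))
          dead⇒active : ∀ y → Dead n (toℕ y) → insertMax τ (punchIn (inject₁ g) (punchIn g y)) ∈ avoiders (suc (suc n))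
          dead⇒active y y-dead = Equivalence.from (∈-avoiders-insertMax τ _ τ-inj)
            (insertMax-dead-avoids τ _ τ-inj τ-avoids (Equivalence.from (dead-after-live⇔ g g-live y) y-dead))

      -- c dead gaps with 1 + childCount grandchildren each and childCount - c live ones with c + 2 each.
      grandchildren-affine :
        weightedCount (suc n) (G₁.active? σ) (grandchildCount σ) + suc c * c ≡ 2 * suc c * childCount σ
      grandchildren-affine = +-cancelʳ-≡ c _ _ (begin
        W + suc c * c + c                                     ≡⟨ shift W c ⟩
        W + suc (suc c) * c                                   ≡⟨ cong (λ d → W + suc (suc c) * d) (sym dead-gaps) ⟩
        W + suc (suc c) * count (suc n) deadGap?                ≡⟨ split ⟩
        suc f * count (suc n) deadGap? + suc (suc c) * f        ≡⟨ cong (λ d → suc f * d + suc (suc c) * f) dead-gaps ⟩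
        suc f * c + suc (suc c) * f                           ≡⟨ collect f c ⟩
        2 * suc c * f + c                                     ∎)
        where
          open ≡-Reasoning
          open +-*-Solver
          W = weightedCount (suc n) (G₁.active? σ) (grandchildCount σ)
          f = childCount σ
          deadGap? = λ (g : Fin (suc n)) → dead? (suc n) (toℕ g)
          dead-gaps : count (suc n) deadGap? ≡ c
          dead-gaps = dead-count (suc n) (≤-trans (<⇒≤ l+r<n) (n≤1+n n))
          split = weightedCount-split (suc n) (G₁.active? σ) deadGap? (grandchildCount σ) (suc f) (suc (suc c))
            (λ g g-dead → Equivalence.from (∈-avoiders-insertMax σ g σ-inj) (insertMax-dead-avoids σ g σ-inj σ-avoids g-dead))
            (λ g _ g-dead → dead-grandchildCount g g-dead)
            (λ g active g-live → live-grandchildCount g (Equivalence.to (∈-avoiders-insertMax σ g σ-inj) active) g-live)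
          shift : ∀ W c → W + suc c * c + c ≡ W + suc (suc c) * c
          shift = solve 2 (λ W c → W :+ (con 1 :+ c) :* c :+ c := W :+ (con 2 :+ c) :* c) refl
          collect : ∀ f c → suc f * c + suc (suc c) * f ≡ 2 * suc c * f + c
          collect = solve 2 (λ f c → (con 1 :+ f) :* c :+ (con 2 :+ c) :* f := con 2 :* (con 1 :+ c) :* f :+ c) refl

    recurrence : a (suc (suc n)) + suc c * c * a n ≡ 2 * suc c * a (suc n)
    recurrence = begin
      a (suc (suc n)) + suc c * c * a n
        ≡⟨ cong₂ (λ u v → u + suc c * c * v) a-grandchildren (sym (length-avoiders n)) ⟩
      sum (map (λ σ → weightedCount (suc n) (G₁.active? σ) (grandchildCount σ)) (avoiders n)) + suc c * c * length (avoiders n)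
        ≡⟨ sum-map-affine _ childCount (suc c * c) (2 * suc c) (avoiders n)
             (λ σ σ∈ → let σ-inj , σ-avoids = Equivalence.to (∈-avoiders n σ) σ∈ in
                       grandchildren-affine σ σ-inj σ-avoids) ⟩
      2 * suc c * sum (map childCount (avoiders n))
        ≡⟨ cong (2 * suc c *_) G₁.a≡sum-count ⟨
      2 * suc c * a (suc n) ∎
      where
        open ≡-Reasoning
        a-grandchildren : a (suc (suc n)) ≡ sum (map (λ σ → weightedCount (suc n) (G₁.active? σ) (grandchildCount σ)) (avoiders n))
        a-grandchildren = trans G₂.a≡sum-count
          (G₁.sum-map-children (λ τ → count (suc (suc n)) (G₂.active? τ)) (avoiders n))

theorem6 : (k i : ℕ) → 3 ≤ k → 1 ≤ i → i ≤ k ∸ 2 →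
    (a : ℕ → ℕ) → ((n : ℕ) → NumAvoiders k (A-i-i+2 k i) n (a n)) →
    ((n : ℕ) → n < k → a n ≡ n !) ×
    ((n : ℕ) → k ≤ suc (suc n) →
      a (suc (suc n)) + (k ∸ 2) * (k ∸ 3) * a n ≡ 2 * (k ∸ 2) * a (suc n))
theorem6 (suc (suc (suc k′))) (suc l) (s≤s (s≤s (s≤s _))) (s≤s z≤n) (s≤s l≤k′) a hyp with m≤n⇒∃[o]m+o≡n l≤k′
... | r , refl = a-small , λ { n (s≤s (s≤s l+r<n)) → Step.recurrence n l+r<n }
  where open Recurrence l r a hyp
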